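{- Let $n,p,\ell\in\mathbb{N}$ with $\ell\le 2^{n-1}$. If $b(Q_n^p)\ge 2^{n-1}+\ell$, then there exists a set $A\subseteq 2^{[n]}$ with $|A|=2\ell$ that is a clique in $Q_n^p$ (i.e. $|x\triangle y|\le p$ for all $x,y\in A$) and satisfies $|C^p(A)|\ge 2^{n-1}-\ell$.
   Context: $2^{[n]}$ is the power set of $[n]=\{1,\dots,n\}$. The hypercube $Q_n$ has vertex set $2^{[n]}$, with $x,y$ adjacent iff $|x\triangle y|=1$; its distance is $d(x,y)=|x\triangle y|$. The $p$-th power $Q_n^p$ has the same vertex set, with distinct $x,y$ adjacent iff $|x\triangle y|\le p$. For $A\subseteq 2^{[n]}$, $C^p[A]=\{y\in 2^{[n]}: |x\triangle y|\le p\ \forall x\in A\}$ and $C^p(A)=C^p[A]\setminus A$. A b-coloring of a graph $G$ with $k$ colors is a proper vertex coloring with $k$ colors in which every color class contains a vertex adjacent to at least one vertex of every other color class; the b-chromatic number $b(G)$ is the largest $k$ for which $G$ has a b-coloring with $k$ colors. -}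

module Defs where

open import Data.Nat using (ℕ; _≤_)
open import Data.Bool using (_xor_)
open import Data.Fin using (Fin)
open import Data.Fin.Subset using (Subset; ∣_∣)
open import Data.Vec using (zipWith)
open import Data.List using (List; length)
open import Data.List.Membership.Propositional using (_∈_; _∉_)
open import Data.List.Relation.Unary.Unique.Propositional using (Unique)
open import Data.Product using (Σ; ∃; _×_)
open import Relation.Binary.PropositionalEquality using (_≡_; _≢_)

-- Vertices of Q_n: subsets of [n], encoded as characteristic vectors Subset n = Vec Bool n.
Vertex : ℕ → Set
Vertex n = Subset n

_△_ : ∀ {n} → Vertex n → Vertex n → Vertex n
x △ y = zipWith _xor_ x y

dist : ∀ {n} → Vertex n → Vertex n → ℕ
dist x y = ∣ x △ y ∣

Adj : ∀ {n} → ℕ → Vertex n → Vertex n → Set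
Adj p x y = (x ≢ y) × (dist x y ≤ p)

record IsBColoring (n p k : ℕ) (c : Vertex n → Fin k) : Set where
  field
    proper    : ∀ x y → Adj p x y → c x ≢ c y
    dominant  : ∀ (i : Fin k) → Σ (Vertex n) λ v →
                  (c v ≡ i) × (∀ (j : Fin k) → j ≢ i →
                    Σ (Vertex n) λ w → Adj p v w × (c w ≡ j))

HasBColoring : (n p k : ℕ) → Set
HasBColoring n p k = Σ (Vertex n → Fin k) (IsBColoring n p k)

-- b(Q_n^p) ≥ m  (b is the largest k admitting a b-coloring; Q_n^p is finite)
bChromatic≥ : (n p m : ℕ) → Set
bChromatic≥ n p m = ∃ λ k → (m ≤ k) × HasBColoring n p k

-- A (given as a duplicate-free list) is a clique in Q_n^p
IsClique : ∀ {n} → ℕ → List (Vertex n) → Set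
IsClique p A = ∀ {x y} → x ∈ A → y ∈ A → dist x y ≤ p

InCBracket : ∀ {n} → ℕ → List (Vertex n) → Vertex n → Set
InCBracket p A y = ∀ {x} → x ∈ A → dist x y ≤ p

InCParen : ∀ {n} → ℕ → List (Vertex n) → Vertex n → Set
InCParen p A y = InCBracket p A y × (y ∉ A)

CardCParen≥ : ∀ {n} → ℕ → List (Vertex n) → ℕ → Set
CardCParen≥ {n} p A m = Σ (List (Vertex n)) λ B →
  Unique B × (m ≤ length B) × (∀ {y} → y ∈ B → InCParen p A y)

-- Among k ≥ 2^(n-1) + ℓ colour classes covering the 2^n vertices, the
-- b-vertices together with a second vertex from every class of size at least
-- two are pairwise distinct, so at least 2k - 2^n ≥ 2ℓ classes are singletons.
-- The b-vertex of any colour j has a neighbour in each other class, hence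
-- within distance p of the unique vertex of every singleton class i ≠ j.
-- So the vertices of 2ℓ singleton classes form the clique A, and the
-- b-vertices of the remaining k - 2ℓ ≥ 2^(n-1) - ℓ colours lie in C^p(A).
module Submission where

open import Defs
open import Data.Nat using (ℕ; _≤_; _+_; _*_; _∸_; _^_)
open import Data.List using (List; length)
open import Data.List.Relation.Unary.Unique.Propositional using (Unique)
open import Data.Product using (Σ; _×_)
open import Relation.Binary.PropositionalEquality using (_≡_)

open import Data.Nat using (zero; suc; z≤n; s≤s)
open import Data.Nat.Properties
open import Data.Bool using (true; false)
open import Data.Bool.Properties using (xor-comm) renaming (_≟_ to _≟ᵇ_)
open import Data.Fin using (Fin) renaming (_≟_ to _≟ᶠ_)
open import Data.Fin.Properties using (injective⇒≤)
open import Data.Fin.Subset using (∣_∣)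
open import Data.Fin.Subset.Properties using (anySubset?)
open import Data.Vec using ([]; _∷_)
open import Data.Vec.Properties using (zipWith-comm; ≡-dec)
open import Data.List using ([]; _∷_; map; _++_; filter; take; drop; lookup; allFin)
open import Data.List.Properties
  using (length-map; length-++; length-take; length-tabulate; take++drop≡id; ++-assoc)
open import Data.List.Membership.Propositional using (_∈_; _∉_)
open import Data.List.Membership.Propositional.Properties
  using (∈-map⁺; ∈-map⁻; ∈-++⁺ˡ; ∈-++⁺ʳ; ∈-filter⁻; ∈-lookup)
open import Data.List.Relation.Unary.Any using (here; there; index)
open import Data.List.Relation.Unary.Any.Properties using (lookup-index)
import Data.List.Relation.Unary.All as All
import Data.List.Relation.Unary.All.Properties as All
open import Data.List.Relation.Unary.AllPairs using ([]; _∷_)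
open import Data.List.Relation.Binary.Disjoint.Propositional using (Disjoint)
import Data.List.Relation.Unary.Unique.Propositional.Properties as Unique
open import Data.Product using (_,_; proj₁; proj₂; ∃)
open import Data.Empty using (⊥)
open import Function using (_∘_; id; Injective)
open import Relation.Nullary using (¬_; Dec; yes; no; contradiction; ¬?)
open import Relation.Nullary.Decidable using (_×-dec_)
open import Relation.Unary using (Pred; Decidable)
open import Relation.Unary.Properties using (∁?)
open import Relation.Binary.PropositionalEquality
  using (_≢_; refl; sym; trans; cong; cong₂; subst; module ≡-Reasoning)

module _ {a} {A : Set a} where

  Unique-++⁻ : ∀ xs {ys : List A} → Unique (xs ++ ys) →
               Unique xs × Unique ys × Disjoint xs ys
  Unique-++⁻ []       ys!             = [] , ys! , λ ()
  Unique-++⁻ (x ∷ xs) (x∉ ∷ xs++ys!) with Unique-++⁻ xs xs++ys!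
  ... | xs! , ys! , xs#ys = All.++⁻ˡ xs x∉ ∷ xs! , ys! , λ where
    (here refl  , y∈ys) → All.lookup (All.++⁻ʳ xs x∉) y∈ys refl
    (there x∈xs , y∈ys) → xs#ys (x∈xs , y∈ys)

  Unique⇒lookup-injective : ∀ {xs : List A} → Unique xs → Injective _≡_ _≡_ (lookup xs)
  Unique⇒lookup-injective (_  ∷ _)   {Fin.zero}  {Fin.zero}  _ = refl
  Unique⇒lookup-injective (x∉ ∷ _)   {Fin.zero}  {Fin.suc j} e = contradiction e (All.lookup x∉ (∈-lookup j))
  Unique⇒lookup-injective (x∉ ∷ _)   {Fin.suc i} {Fin.zero}  e = contradiction (sym e) (All.lookup x∉ (∈-lookup i))
  Unique⇒lookup-injective (_  ∷ xs!) {Fin.suc i} {Fin.suc j} e = cong Fin.suc (Unique⇒lookup-injective xs! e)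

  Unique⇒length≤enumeration : ∀ {xs ys : List A} → Unique xs → (∀ x → x ∈ ys) →
                              length xs ≤ length ys
  Unique⇒length≤enumeration {xs} {ys} xs! ys-complete = injective⇒≤ position-injective
    where
    position : Fin (length xs) → Fin (length ys)
    position i = index (ys-complete (lookup xs i))

    position-injective : Injective _≡_ _≡_ position
    position-injective {i} {j} e = Unique⇒lookup-injective xs! (begin
      lookup xs i             ≡⟨ lookup-index (ys-complete (lookup xs i)) ⟩
      lookup ys (position i)  ≡⟨ cong (lookup ys) e ⟩
      lookup ys (position j)  ≡⟨ lookup-index (ys-complete (lookup xs j)) ⟨
      lookup xs j             ∎)
      where open ≡-Reasoning

  length-filter+length-filter-∁ : ∀ {p} {P : Pred A p} (P? : Decidable P) xs →
    length (filter P? xs) + length (filter (∁? P?) xs) ≡ length xs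
  length-filter+length-filter-∁ P? []       = refl
  length-filter+length-filter-∁ P? (x ∷ xs) with P? x
  ... | yes _ = cong suc (length-filter+length-filter-∁ P? xs)
  ... | no  _ = trans (+-suc _ _) (cong suc (length-filter+length-filter-∁ P? xs))

vertices : ∀ n → List (Vertex n)
vertices zero    = [] ∷ []
vertices (suc n) = map (true ∷_) (vertices n) ++ map (false ∷_) (vertices n)

length-vertices : ∀ n → length (vertices n) ≡ 2 ^ n
length-vertices zero    = refl
length-vertices (suc n) = begin
  length (map (true ∷_) (vertices n) ++ map (false ∷_) (vertices n))
    ≡⟨ length-++ (map (true ∷_) (vertices n)) ⟩
  length (map (true ∷_) (vertices n)) + length (map (false ∷_) (vertices n))
    ≡⟨ cong₂ _+_ (length-map (true ∷_) (vertices n)) (length-map (false ∷_) (vertices n)) ⟩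
  length (vertices n) + length (vertices n)
    ≡⟨ cong₂ _+_ (length-vertices n) (trans (length-vertices n) (sym (+-identityʳ _))) ⟩
  2 ^ suc n ∎
  where open ≡-Reasoning

∈-vertices : ∀ {n} (v : Vertex n) → v ∈ vertices n
∈-vertices []                = here refl
∈-vertices {suc n} (true ∷ v)  = ∈-++⁺ˡ (∈-map⁺ (true ∷_) (∈-vertices v))
∈-vertices {suc n} (false ∷ v) = ∈-++⁺ʳ (map (true ∷_) (vertices n)) (∈-map⁺ (false ∷_) (∈-vertices v))

_≟ᵛ_ : ∀ {n} (x y : Vertex n) → Dec (x ≡ y)
_≟ᵛ_ = ≡-dec _≟ᵇ_

dist-sym : ∀ {n} (x y : Vertex n) → dist x y ≡ dist y x
dist-sym x y = cong ∣_∣ (zipWith-comm xor-comm x y)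

dist-self : ∀ {n} (x : Vertex n) → dist x x ≡ 0
dist-self []          = refl
dist-self (true ∷ x)  = dist-self x
dist-self (false ∷ x) = dist-self x

CardCParen≥-mono : ∀ {n p} {A : List (Vertex n)} {m m′} → m′ ≤ m →
                   CardCParen≥ p A m → CardCParen≥ p A m′
CardCParen≥-mono m′≤m (B , B! , m≤|B| , B⊆C) = B , B! , ≤-trans m′≤m m≤|B| , B⊆C

module BColouring {n p k} {c : Vertex n → Fin k} (b : IsBColoring n p k c) where
  open IsBColoring b

  bVertex : Fin k → Vertex n
  bVertex i = proj₁ (dominant i)

  bVertex-colour : ∀ i → c (bVertex i) ≡ i
  bVertex-colour i = proj₁ (proj₂ (dominant i))

  bVertex-injective : Injective _≡_ _≡_ bVertex
  bVertex-injective {i} {j} e = trans (sym (bVertex-colour i)) (trans (cong c e) (bVertex-colour j))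

  HasTwin : Fin k → Set
  HasTwin i = ∃ λ v → c v ≡ i × v ≢ bVertex i

  hasTwin? : Decidable HasTwin
  hasTwin? i = anySubset? λ v → (c v ≟ᶠ i) ×-dec ¬? (v ≟ᵛ bVertex i)

  singleton-class : ∀ {i v} → ¬ HasTwin i → c v ≡ i → v ≡ bVertex i
  singleton-class {i} {v} no-twin cv≡i with v ≟ᵛ bVertex i
  ... | yes v≡b = v≡b
  ... | no  v≢b = contradiction (v , cv≡i , v≢b) no-twin

  twin : Fin k → Vertex n
  twin i with hasTwin? i
  ... | yes (v , _) = v
  ... | no  _       = bVertex i

  twin-colour : ∀ i → c (twin i) ≡ i
  twin-colour i with hasTwin? i
  ... | yes (_ , cv≡i , _) = cv≡i
  ... | no  _              = bVertex-colour i

  twin-≢ : ∀ {i} → HasTwin i → twin i ≢ bVertex i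
  twin-≢ {i} has-twin with hasTwin? i
  ... | yes (_ , _ , v≢b) = v≢b
  ... | no  no-twin       = contradiction has-twin no-twin

  singletons twinned : List (Fin k)
  singletons = filter (∁? hasTwin?) (allFin k)
  twinned    = filter hasTwin? (allFin k)

  ∈twinned⇒HasTwin : ∀ {i} → i ∈ twinned → HasTwin i
  ∈twinned⇒HasTwin = proj₂ ∘ ∈-filter⁻ hasTwin? {xs = allFin k}

  length-singletons+twinned : length singletons + length twinned ≡ k
  length-singletons+twinned = trans (+-comm (length singletons) _)
    (trans (length-filter+length-filter-∁ hasTwin? (allFin k)) (length-tabulate id))

  twin-injective : Injective _≡_ _≡_ twin
  twin-injective {i} {j} e = trans (sym (twin-colour i)) (trans (cong c e) (twin-colour j))

  bVertex≢twin : ∀ {i j} → HasTwin j → bVertex i ≢ twin j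
  bVertex≢twin {i} {j} has-twin bᵢ≡tⱼ = twin-≢ has-twin (begin
    twin j     ≡⟨ bᵢ≡tⱼ ⟨
    bVertex i  ≡⟨ cong bVertex i≡j ⟩
    bVertex j  ∎)
    where
    open ≡-Reasoning
    i≡j : i ≡ j
    i≡j = trans (sym (bVertex-colour i)) (trans (cong c bᵢ≡tⱼ) (twin-colour j))

  -- The b-vertices and the twins of the twinned colours are pairwise distinct.
  k+k≤2^n+singletons : k + k ≤ 2 ^ n + length singletons
  k+k≤2^n+singletons = begin
    k + k                                     ≡⟨ cong (k +_) length-singletons+twinned ⟨
    k + (length singletons + length twinned)  ≡⟨ cong (k +_) (+-comm (length singletons) _) ⟩
    k + (length twinned + length singletons)  ≡⟨ +-assoc k _ _ ⟨
    k + length twinned + length singletons    ≡⟨ cong (_+ length singletons) length-witnesses ⟨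
    length witnesses + length singletons      ≤⟨ +-monoˡ-≤ _ witnesses-fit ⟩
    2 ^ n + length singletons                 ∎
    where
    open ≤-Reasoning
    witnesses : List (Vertex n)
    witnesses = map bVertex (allFin k) ++ map twin twinned

    witnesses! : Unique witnesses
    witnesses! = Unique.++⁺ (Unique.map⁺ bVertex-injective (Unique.allFin⁺ k))
      (Unique.map⁺ twin-injective (Unique.filter⁺ hasTwin? (Unique.allFin⁺ k)))
      λ (b∈ , t∈) → distinct (∈-map⁻ bVertex b∈) (∈-map⁻ twin t∈)
      where
      distinct : ∀ {x} → ∃ (λ i → i ∈ allFin k × x ≡ bVertex i) →
                 ∃ (λ j → j ∈ twinned × x ≡ twin j) → ⊥
      distinct (_ , _ , x≡b) (_ , j∈ , x≡t) =
        bVertex≢twin (∈twinned⇒HasTwin j∈) (trans (sym x≡b) x≡t)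

    length-witnesses : length witnesses ≡ k + length twinned
    length-witnesses = begin-equality
      length witnesses
        ≡⟨ length-++ (map bVertex (allFin k)) ⟩
      length (map bVertex (allFin k)) + length (map twin twinned)
        ≡⟨ cong₂ _+_ (trans (length-map bVertex (allFin k)) (length-tabulate id))
                     (length-map twin twinned) ⟩
      k + length twinned ∎

    witnesses-fit : length witnesses ≤ 2 ^ n
    witnesses-fit = subst (length witnesses ≤_) (length-vertices n)
      (Unique⇒length≤enumeration witnesses! ∈-vertices)

  ∈singletons⇒¬HasTwin : ∀ {i} → i ∈ singletons → ¬ HasTwin i
  ∈singletons⇒¬HasTwin = proj₂ ∘ ∈-filter⁻ (∁? hasTwin?) {xs = allFin k}

  -- The only vertex of colour i is bVertex i, so it is the neighbour of colour i
  -- that the b-vertex of j is guaranteed to have.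
  singleton-near : ∀ {i j} → ¬ HasTwin i → i ≢ j → dist (bVertex i) (bVertex j) ≤ p
  singleton-near {i} {j} no-twin i≢j with proj₂ (proj₂ (dominant j)) i i≢j
  ... | w , (_ , bⱼw≤p) , cw≡i = subst (_≤ p) dist-bⱼw≡dist-bᵢbⱼ bⱼw≤p
    where
    dist-bⱼw≡dist-bᵢbⱼ : dist (bVertex j) w ≡ dist (bVertex i) (bVertex j)
    dist-bⱼw≡dist-bᵢbⱼ = trans (dist-sym (bVertex j) w)
      (cong (λ v → dist v (bVertex j)) (singleton-class no-twin cw≡i))

  clique-and-cone : ∀ {I J} → Unique I → Unique J → All.All (¬_ ∘ HasTwin) I → Disjoint I J →
    Unique (map bVertex I) × IsClique p (map bVertex I)
      × CardCParen≥ p (map bVertex I) (length J)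
  clique-and-cone {I} {J} I! J! I-singletons I#J =
    Unique.map⁺ bVertex-injective I! , clique ,
    (map bVertex J , Unique.map⁺ bVertex-injective J! , ≤-reflexive (sym (length-map bVertex J)) , cone)
    where
    A = map bVertex I

    near : ∀ {i j} → i ∈ I → i ≢ j → dist (bVertex i) (bVertex j) ≤ p
    near i∈I = singleton-near (All.lookup I-singletons i∈I)

    clique : IsClique p A
    clique x∈A y∈A with ∈-map⁻ bVertex x∈A | ∈-map⁻ bVertex y∈A
    ... | i , i∈I , refl | j , _ , refl with i ≟ᶠ j
    ...   | yes refl = subst (_≤ p) (sym (dist-self (bVertex i))) z≤n
    ...   | no  i≢j  = near i∈I i≢j

    cone : ∀ {y} → y ∈ map bVertex J → InCParen p A y
    cone y∈ with ∈-map⁻ bVertex y∈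
    ... | j , j∈J , refl = bracket , bⱼ∉A
      where
      bracket : InCBracket p A (bVertex j)
      bracket x∈A with ∈-map⁻ bVertex x∈A
      ... | i , i∈I , refl = near i∈I λ { refl → I#J (i∈I , j∈J) }

      bⱼ∉A : bVertex j ∉ A
      bⱼ∉A bⱼ∈A with ∈-map⁻ bVertex bⱼ∈A
      ... | i , i∈I , bⱼ≡bᵢ with bVertex-injective bⱼ≡bᵢ
      ...   | refl = I#J (i∈I , j∈J)

  singleton-clique : ∀ m → m ≤ length singletons →
    Σ (List (Vertex n)) λ A → Unique A × length A ≡ m × IsClique p A
      × CardCParen≥ p A (k ∸ m)
  singleton-clique m m≤|S| =
    let I! , J! , I#J = Unique-++⁻ I (subst Unique (sym I++J≡colours) colours!)
        A! , clique , cone = clique-and-cone I! J! I-singletons I#J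
    in map bVertex I , A! , trans (length-map bVertex I) |I|≡m , clique
         , CardCParen≥-mono (≤-reflexive k∸m≡|J|) cone
    where
    I J : List (Fin k)
    I = take m singletons
    J = drop m singletons ++ twinned

    I++J≡colours : I ++ J ≡ singletons ++ twinned
    I++J≡colours = trans (sym (++-assoc I _ twinned)) (cong (_++ twinned) (take++drop≡id m singletons))

    colours! : Unique (singletons ++ twinned)
    colours! = Unique.++⁺ (Unique.filter⁺ (∁? hasTwin?) (Unique.allFin⁺ k))
      (Unique.filter⁺ hasTwin? (Unique.allFin⁺ k))
      λ (i∈S , i∈T) → ∈singletons⇒¬HasTwin i∈S (∈twinned⇒HasTwin i∈T)

    I-singletons : All.All (¬_ ∘ HasTwin) I
    I-singletons = All.take⁺ m (All.all-filter (∁? hasTwin?) (allFin k))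

    |I|≡m : length I ≡ m
    |I|≡m = trans (length-take m singletons) (m≤n⇒m⊓n≡m m≤|S|)

    m+|J|≡k : m + length J ≡ k
    m+|J|≡k = begin
      m + length J                           ≡⟨ cong (_+ length J) |I|≡m ⟨
      length I + length J                    ≡⟨ length-++ I ⟨
      length (I ++ J)                        ≡⟨ cong length I++J≡colours ⟩
      length (singletons ++ twinned)         ≡⟨ length-++ singletons ⟩
      length singletons + length twinned     ≡⟨ length-singletons+twinned ⟩
      k                                      ∎
      where open ≡-Reasoning

    k∸m≡|J| : k ∸ m ≡ length J
    k∸m≡|J| = trans (cong (_∸ m) (sym m+|J|≡k)) (m+n∸m≡n m (length J))

2^n≤2*2^[n∸1] : ∀ n → 2 ^ n ≤ 2 * 2 ^ (n ∸ 1)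
2^n≤2*2^[n∸1] zero    = s≤s z≤n
2^n≤2*2^[n∸1] (suc n) = ≤-refl

m+n≤o⇒o+o≤2m+s⇒2n≤s : ∀ m n {o s} → m + n ≤ o → o + o ≤ 2 * m + s → 2 * n ≤ s
m+n≤o⇒o+o≤2m+s⇒2n≤s m n {o} {s} m+n≤o o+o≤2m+s = +-cancelˡ-≤ (2 * m) _ _ (begin
  2 * m + 2 * n        ≡⟨ *-distribˡ-+ 2 m n ⟨
  2 * (m + n)          ≡⟨ cong ((m + n) +_) (+-identityʳ (m + n)) ⟩
  (m + n) + (m + n)    ≤⟨ +-mono-≤ m+n≤o m+n≤o ⟩
  o + o                ≤⟨ o+o≤2m+s ⟩
  2 * m + s            ∎)
  where open ≤-Reasoning

m+n≤o⇒m∸n≤o∸2n : ∀ m n {o} → m + n ≤ o → m ∸ n ≤ o ∸ 2 * n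
m+n≤o⇒m∸n≤o∸2n m n {o} m+n≤o = begin
  m ∸ n                ≡⟨ [m+n]∸[m+o]≡n∸o n m n ⟨
  (n + m) ∸ (n + n)    ≡⟨ cong₂ _∸_ (+-comm n m) (cong (n +_) (sym (+-identityʳ n))) ⟩
  (m + n) ∸ 2 * n      ≤⟨ ∸-monoˡ-≤ (2 * n) m+n≤o ⟩
  o ∸ 2 * n            ∎
  where open ≤-Reasoning

lemma4p1 : (n p ℓ : ℕ) → ℓ ≤ 2 ^ (n ∸ 1) →
    bChromatic≥ n p (2 ^ (n ∸ 1) + ℓ) →
    Σ (List (Vertex n)) λ A →
      Unique A × (length A ≡ 2 * ℓ) × IsClique p A
        × CardCParen≥ p A (2 ^ (n ∸ 1) ∸ ℓ)
lemma4p1 n p ℓ _ (k , M+ℓ≤k , c , b) =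
  let A , A! , |A|≡2ℓ , clique , cone = singleton-clique (2 * ℓ) 2ℓ≤|singletons|
  in A , A! , |A|≡2ℓ , clique , CardCParen≥-mono (m+n≤o⇒m∸n≤o∸2n (2 ^ (n ∸ 1)) ℓ M+ℓ≤k) cone
  where
  open BColouring b
  2ℓ≤|singletons| : 2 * ℓ ≤ length singletons
  2ℓ≤|singletons| = m+n≤o⇒o+o≤2m+s⇒2n≤s (2 ^ (n ∸ 1)) ℓ M+ℓ≤k
    (≤-trans k+k≤2^n+singletons (+-monoˡ-≤ (length singletons) (2^n≤2*2^[n∸1] n)))
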